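{- Let $H$ be an induced subgraph of a reduced maximal Gallai multigraph $(G,\rho)$ and $n\ge0$ such that $T=M_n(H)=(\mathcal V,\mathcal E,\mathcal A)$ has exactly one weak component, so that its directed edges form a rooted tree, with root $R$. Let $\mathrm{tc}(T)=\bigcup\{\rho[RW]:W\in\mathcal V\setminus\{R\}\}$. If $\{U,W\}\in\mathcal E$ and $\rho[UW]\not\subseteq\mathrm{tc}(T)$, then $\Sigma(R,U)=\Sigma(R,W)$.
   Context: An edge-colored (complete, loopless) multigraph $(G,\rho)$ has a finite vertex set $\subseteq\mathbb N$, ordered by the usual order of $\mathbb N$, and assigns to each unordered pair of distinct vertices $u,v$ a nonempty finite set $\rho[uv]$ of colors (parallel edges have distinct colors). For vertex sets $U,W$ let $\rho[UW]=\bigcup\{\rho[uw]:u\in U,w\in W,u\ne w\}$. Three distinct vertices form a rainbow triangle if one can pick pairwise distinct colors from the three color sets of its sides. $(G,\rho)$ is Gallai if it has no rainbow triangle; maximal if for every pair $u,v$ and color $B\notin\rho[uv]$, adding $B$ to $\rho[uv]$ would create a rainbow triangle; reduced if there is no pair $u,v$ with $\rho[uw]=\rho[vw]$ and $|\rho[uw]|=1$ for all $w\notin\{u,v\}$. Dominance: for disjoint nonempty vertex sets $U,V$, $U\triangleright V$ iff $|\rho[UV]|>1$ and either (a) $U=\{u\}$, $V=\{v\}$, $u<v$, or (b) $|U|>1$ or $|V|>1$, and $\rho[uv]=\rho[uV]$ for all $u\in U,v\in V$. The signature $\Sigma(U,V)$ is the map on $U$ given by $u\mapsto\rho[uV]$.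 Mixed graphs: weak components are the components of the graph given by the directed edges with directions forgotten (undirected edges ignored). A rooted tree is a transitive directed graph whose transitive reduction is a tree; its root is the unique vertex with a directed edge to every other vertex. For an induced subgraph $H$ define $M_n(H)=(\mathcal V_n,\mathcal E_n,\mathcal A_n)$: $\mathcal V_0=V(H)$, $\mathcal A_0=\{(u,v):u\triangleright v\}$, $\mathcal E_0=\{\{u,v\}:|\rho[uv]|=1\}$; for $n\ge1$, $\mathcal V_n$ is the partition of $V(H)$ whose blocks are the unions of the members of $\mathcal V_{n-1}$ lying in one weak component of $M_{n-1}(H)$, $\mathcal A_n=\{(U,W)\in\mathcal V_n^2:U\triangleright W\}$, $\mathcal E_n=\{\{U,W\}:U\neq W,\ |\rho[UW]|=1\}$. (It is known that each weak component of $M_n(H)$ is a rooted tree.) -}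

module Defs where

open import Data.Nat using (ℕ; zero; suc; _<_)
open import Data.List using (List)
open import Data.List.Membership.Propositional using (_∈_; _∉_)
open import Data.Product using (Σ; ∃; _×_; _,_)
open import Data.Sum using (_⊎_)
open import Relation.Nullary using (¬_)
open import Relation.Binary.PropositionalEquality using (_≡_; _≢_)
open import Relation.Binary.Construct.Closure.Equivalence using (EqClosure)
open import Function.Bundles using (_⇔_)

-- Vertices are natural numbers (ordered by the usual order of ℕ); colours are
-- natural numbers (an infinite supply of colours).  A colouring assigns to each
-- pair of vertices a finite list of colours, read as a finite SET of colours
-- (only membership matters; duplicates and order are irrelevant).
Colouring : Set
Colouring = ℕ → ℕ → List ℕ

VSet : Set₁
VSet = ℕ → Set

-- (V, ρ) is an edge-coloured complete loopless multigraph on the finite vertex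
-- set V: every pair of distinct vertices gets a nonempty colour set, and the
-- colour set of an unordered pair does not depend on the order.
record IsMultigraph (V : List ℕ) (ρ : Colouring) : Set where
  field
    nonempty  : ∀ {u v} → u ∈ V → v ∈ V → u ≢ v → ∃ λ c → c ∈ ρ u v
    symmetric : ∀ {u v c} → u ∈ V → v ∈ V → u ≢ v → c ∈ ρ u v → c ∈ ρ v u

Rainbow : List ℕ → (ℕ → ℕ → ℕ → Set) → Set
Rainbow V col =
  ∃ λ u → ∃ λ v → ∃ λ w →
    u ∈ V × v ∈ V × w ∈ V × u ≢ v × v ≢ w × u ≢ w ×
    (∃ λ a → ∃ λ b → ∃ λ c →
       col u v a × col v w b × col u w c × a ≢ b × b ≢ c × a ≢ c)

colOf : Colouring → ℕ → ℕ → ℕ → Set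
colOf ρ x y c = c ∈ ρ x y

Gallai : List ℕ → Colouring → Set
Gallai V ρ = ¬ Rainbow V (colOf ρ)

addColour : Colouring → ℕ → ℕ → ℕ → ℕ → ℕ → ℕ → Set
addColour ρ u v B x y c =
  c ∈ ρ x y ⊎ (((x ≡ u × y ≡ v) ⊎ (x ≡ v × y ≡ u)) × c ≡ B)

Maximal : List ℕ → Colouring → Set
Maximal V ρ = ∀ {u v B} → u ∈ V → v ∈ V → u ≢ v → B ∉ ρ u v →
  Rainbow V (addColour ρ u v B)

IsOneColour : (ℕ → Set) → Set
IsOneColour P = ∃ λ c → ∀ c' → P c' ⇔ (c' ≡ c)

Reduced : List ℕ → Colouring → Set
Reduced V ρ = ¬ (∃ λ u → ∃ λ v → u ∈ V × v ∈ V × u ≢ v ×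
  (∀ w → w ∈ V → w ≢ u → w ≢ v →
     (∀ c → c ∈ ρ u w ⇔ c ∈ ρ v w) × IsOneColour (colOf ρ u w)))

Cols : Colouring → VSet → VSet → ℕ → Set
Cols ρ U W c = ∃ λ u → ∃ λ w → U u × W w × u ≢ w × c ∈ ρ u w

Singleton : ℕ → VSet
Singleton x y = y ≡ x

AtLeastTwo : (ℕ → Set) → Set
AtLeastTwo P = ∃ λ a → ∃ λ b → P a × P b × a ≢ b

Nonempty : VSet → Set
Nonempty U = ∃ λ x → U x

Disjoint : VSet → VSet → Set
Disjoint U W = ∀ x → U x → W x → Data.Empty.⊥
  where import Data.Empty

IsSingletonOf : VSet → ℕ → Set
IsSingletonOf U u = ∀ x → U x ⇔ (x ≡ u)

Dom : Colouring → VSet → VSet → Set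
Dom ρ U V =
  Disjoint U V × Nonempty U × Nonempty V × AtLeastTwo (Cols ρ U V) ×
  ( (∃ λ u → ∃ λ v → IsSingletonOf U u × IsSingletonOf V v × u < v)
  ⊎ ((AtLeastTwo U ⊎ AtLeastTwo V) ×
     (∀ u v → U u → V v → ∀ c → c ∈ ρ u v ⇔ Cols ρ (Singleton u) V c)))

Block : List ℕ → (ℕ → ℕ → Set) → ℕ → VSet
Block VH R x y = y ∈ VH × R x y

-- x and y are joined in M by R-equality or by a directed edge (either way)
Link : Colouring → List ℕ → (ℕ → ℕ → Set) → ℕ → ℕ → Set
Link ρ VH R x y =
  R x y ⊎ Dom ρ (Block VH R x) (Block VH R y) ⊎ Dom ρ (Block VH R y) (Block VH R x)

-- Part ρ VH n x y : x and y lie in the same block of the partition 𝒱_n of V(H).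
-- 𝒱_0 = singletons; the blocks of 𝒱_(n+1) are the weak components of M_n(H).
Part : Colouring → List ℕ → ℕ → ℕ → ℕ → Set
Part ρ VH zero x y = x ≡ y
Part ρ VH (suc n) = EqClosure (Link ρ VH (Part ρ VH n))

Blk : Colouring → List ℕ → ℕ → ℕ → VSet
Blk ρ VH n x = Block VH (Part ρ VH n) x

Arc : Colouring → List ℕ → ℕ → ℕ → ℕ → Set
Arc ρ VH n x y = Dom ρ (Blk ρ VH n x) (Blk ρ VH n y)

EdgeM : Colouring → List ℕ → ℕ → ℕ → ℕ → Set
EdgeM ρ VH n x y =
  ¬ Part ρ VH n x y × IsOneColour (Cols ρ (Blk ρ VH n x) (Blk ρ VH n y))

TC : Colouring → List ℕ → ℕ → ℕ → ℕ → Set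
TC ρ VH n r c = ∃ λ w → w ∈ VH × ¬ Part ρ VH n r w ×
  Cols ρ (Blk ρ VH n r) (Blk ρ VH n w) c

module Submission where

-- Write B a for the block of 𝒱_n containing a, R = B r for the
-- root, U = B u and W = B w for the ends of the undirected edge, and c₀ for
-- the single colour of ρ[UW].  The root is different from U and from W: R
-- dominates every other block, so ρ[R·] has at least two colours, whereas
-- ρ[UW] has only one.  Hence every colour between R and U or between R and W
-- lies in tc(T), while the hypothesis says c₀ does not.  Now let x ∈ R and
-- c ∈ ρ[x u′] with u′ ∈ U; choose b ∈ ρ[x w] and d ∈ ρ[u′ w] (so d = c₀).
-- In the triangle x u′ w we have c ≠ d ≠ b, since c, b ∈ tc(T) and d ∉ tc(T),
-- so the Gallai property forces c = b ∈ ρ[x W].  By the symmetry of U and W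
-- this gives Σ(R,U) = Σ(R,W).

open import Defs
open import Data.Nat using (ℕ; suc; zero)
open import Data.Nat.Properties using (_≟_)
open import Data.List using (List)
open import Data.List.Membership.Propositional using (_∈_)
open import Data.Product using (_,_; proj₁; proj₂)
open import Data.Empty using (⊥-elim)
open import Relation.Nullary using (¬_; yes; no)
open import Relation.Binary.PropositionalEquality
  using (_≡_; _≢_; refl; sym; trans; subst)
open import Function.Bundles using (_⇔_; mk⇔; Equivalence)
import Relation.Binary.Construct.Closure.Equivalence as EqClosure

module _ (ρ : Colouring) (VH : List ℕ) where

  Part-refl : ∀ n {x} → Part ρ VH n x x
  Part-refl zero    = refl
  Part-refl (suc n) = EqClosure.reflexive (Link ρ VH (Part ρ VH n))

  Part-sym : ∀ n {x y} → Part ρ VH n x y → Part ρ VH n y x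
  Part-sym zero    = sym
  Part-sym (suc n) = EqClosure.symmetric (Link ρ VH (Part ρ VH n))

  Part-trans : ∀ n {x y z} → Part ρ VH n x y → Part ρ VH n y z → Part ρ VH n x z
  Part-trans zero    = trans
  Part-trans (suc n) = EqClosure.transitive (Link ρ VH (Part ρ VH n))

  Blk-⊆ : ∀ n {a b} → Part ρ VH n a b → ∀ {x} → Blk ρ VH n a x → Blk ρ VH n b x
  Blk-⊆ n a~b (xH , a~x) = xH , Part-trans n (Part-sym n a~b) a~x

Cols-mono : ∀ {ρ U U′ W W′ c} → (∀ {x} → U x → U′ x) → (∀ {x} → W x → W′ x) →
            Cols ρ U W c → Cols ρ U′ W′ c
Cols-mono U⊆U′ W⊆W′ (x , y , Ux , Wy , x≢y , c∈) = x , y , U⊆U′ Ux , W⊆W′ Wy , x≢y , c∈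

Cols-swap : ∀ {V ρ U W c} → IsMultigraph V ρ →
            (∀ {x} → U x → x ∈ V) → (∀ {x} → W x → x ∈ V) →
            Cols ρ U W c → Cols ρ W U c
Cols-swap mg U⊆V W⊆V (x , y , Ux , Wy , x≢y , c∈) =
  y , x , Wy , Ux , (λ y≡x → x≢y (sym y≡x)) ,
  IsMultigraph.symmetric mg (U⊆V Ux) (W⊆V Wy) x≢y c∈

two-not-within-one : ∀ {P Q : ℕ → Set} → AtLeastTwo P → (∀ {c} → P c → Q c) →
                     ¬ IsOneColour Q
two-not-within-one (a , b , Pa , Pb , a≢b) P⊆Q (c , Q⇔c) =
  a≢b (trans (Equivalence.to (Q⇔c a) (P⊆Q Pa)) (sym (Equivalence.to (Q⇔c b) (P⊆Q Pb))))

one-colour-outside : ∀ {P Q : ℕ → Set} → IsOneColour P → ¬ (∀ c → P c → Q c) →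
                     ∀ c → P c → ¬ Q c
one-colour-outside (c₀ , P⇔c₀) P⊈Q c Pc Qc =
  P⊈Q (λ d Pd → subst _ (trans (Equivalence.to (P⇔c₀ c) Pc)
                                (sym (Equivalence.to (P⇔c₀ d) Pd))) Qc)

gallai-triangle : ∀ {V ρ x y z a d b} → Gallai V ρ →
  x ∈ V → y ∈ V → z ∈ V → x ≢ y → y ≢ z → x ≢ z →
  a ∈ ρ x y → d ∈ ρ y z → b ∈ ρ x z → a ≢ d → d ≢ b → a ≡ b
gallai-triangle {a = a} {b = b} gal xV yV zV x≢y y≢z x≢z a∈ d∈ b∈ a≢d d≢b
  with a ≟ b
... | yes a≡b = a≡b
... | no  a≢b = ⊥-elim (gal (_ , _ , _ , xV , yV , zV , x≢y , y≢z , x≢z ,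
                             _ , _ , _ , a∈ , d∈ , b∈ , a≢d , d≢b , a≢b))

module Blocks {VG VH : List ℕ} {ρ : Colouring} (mg : IsMultigraph VG ρ)
              (VH⊆VG : ∀ {x} → x ∈ VH → x ∈ VG) (n : ℕ) where

  private
    B : ℕ → VSet
    B = Blk ρ VH n

  Blk-Cols-swap : ∀ {a b c} → Cols ρ (B a) (B b) c → Cols ρ (B b) (B a) c
  Blk-Cols-swap = Cols-swap mg (λ Bx → VH⊆VG (proj₁ Bx)) (λ Bx → VH⊆VG (proj₁ Bx))

  EdgeM-sym : ∀ {u w} → EdgeM ρ VH n u w → EdgeM ρ VH n w u
  EdgeM-sym (u≁w , c₀ , one) =
    (λ w~u → u≁w (Part-sym ρ VH n w~u)) ,
    c₀ , (λ c → mk⇔ (λ cwu → Equivalence.to (one c) (Blk-Cols-swap cwu))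
                    (λ c≡c₀ → Blk-Cols-swap (Equivalence.from (one c) c≡c₀)))

  -- A block dominating all other blocks is not an end of an undirected edge:
  -- its colours towards the other end would be both one and at least two.
  root-not-on-edge : ∀ {r u w} →
    (∀ {v} → v ∈ VH → ¬ Part ρ VH n r v → Arc ρ VH n r v) →
    w ∈ VH → EdgeM ρ VH n u w → ¬ Part ρ VH n r u
  root-not-on-edge arc wH (u≁w , one) r~u
    with arc wH (λ r~w → u≁w (Part-trans ρ VH n (Part-sym ρ VH n r~u) r~w))
  ... | _ , _ , _ , two , _ =
    two-not-within-one two (Cols-mono (Blk-⊆ ρ VH n r~u) (λ Bx → Bx)) one

  -- Half of Σ(R,U) = Σ(R,W): a colour from x ∈ R to U is also a colour from
  -- x to W, provided R, U, W are distinct and ρ[UW] avoids tc(T).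
  signature-transfer : Gallai VG ρ → ∀ {r u w x c} → u ∈ VH → w ∈ VH →
    ¬ Part ρ VH n u w → ¬ Part ρ VH n r u → ¬ Part ρ VH n r w →
    (∀ d → Cols ρ (B u) (B w) d → ¬ TC ρ VH n r d) →
    B r x → Cols ρ (Singleton x) (B u) c → Cols ρ (Singleton x) (B w) c
  signature-transfer gal {r} {u} {w} {x} {c} uH wH u≁w r≁u r≁w uw∉tc
                     (xH , r~x) (_ , u′ , refl , (u′H , u~u′) , x≢u′ , c∈) =
    x , w , refl , (wH , Part-refl ρ VH n) , x≢w , subst (λ e → e ∈ ρ x w) (sym c≡b) b∈
    where
    x≢w : x ≢ w
    x≢w refl = r≁w r~x
    u′≢w : u′ ≢ w
    u′≢w refl = u≁w u~u′
    b d : ℕ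
    b = proj₁ (IsMultigraph.nonempty mg (VH⊆VG xH) (VH⊆VG wH) x≢w)
    d = proj₁ (IsMultigraph.nonempty mg (VH⊆VG u′H) (VH⊆VG wH) u′≢w)
    b∈ : b ∈ ρ x w
    b∈ = proj₂ (IsMultigraph.nonempty mg (VH⊆VG xH) (VH⊆VG wH) x≢w)
    d∈ : d ∈ ρ u′ w
    d∈ = proj₂ (IsMultigraph.nonempty mg (VH⊆VG u′H) (VH⊆VG wH) u′≢w)
    d∉tc : ¬ TC ρ VH n r d
    d∉tc = uw∉tc d (u′ , w , (u′H , u~u′) , (wH , Part-refl ρ VH n) , u′≢w , d∈)
    c∈tc : TC ρ VH n r c
    c∈tc = u , uH , r≁u , x , u′ , (xH , r~x) , (u′H , u~u′) , x≢u′ , c∈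
    b∈tc : TC ρ VH n r b
    b∈tc = w , wH , r≁w , x , w , (xH , r~x) , (wH , Part-refl ρ VH n) , x≢w , b∈
    c≡b : c ≡ b
    c≡b = gallai-triangle gal (VH⊆VG xH) (VH⊆VG u′H) (VH⊆VG wH) x≢u′ u′≢w x≢w c∈ d∈ b∈
            (λ c≡d → d∉tc (subst (TC ρ VH n r) c≡d c∈tc))
            (λ d≡b → d∉tc (subst (TC ρ VH n r) (sym d≡b) b∈tc))

lemma3p9 : (VG VH : List ℕ) (ρ : Colouring) →
    IsMultigraph VG ρ → Gallai VG ρ → Maximal VG ρ → Reduced VG ρ →
    (∀ {x} → x ∈ VH → x ∈ VG) →
    (n : ℕ) →
    (∀ {x y} → x ∈ VH → y ∈ VH → Part ρ VH (suc n) x y) →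
    (r : ℕ) → r ∈ VH →
    (∀ {w} → w ∈ VH → ¬ Part ρ VH n r w → Arc ρ VH n r w) →
    (u w : ℕ) → u ∈ VH → w ∈ VH → EdgeM ρ VH n u w →
    ¬ (∀ c → Cols ρ (Blk ρ VH n u) (Blk ρ VH n w) c → TC ρ VH n r c) →
    ∀ x → Blk ρ VH n r x → ∀ c →
    Cols ρ (Singleton x) (Blk ρ VH n u) c ⇔ Cols ρ (Singleton x) (Blk ρ VH n w) c
lemma3p9 VG VH ρ mg gal _ _ VH⊆VG n _ r _ arc u w uH wH uw uw⊈tc x rx c =
  mk⇔ (signature-transfer gal uH wH (proj₁ uw) r≁u r≁w uw∉tc rx)
      (signature-transfer gal wH uH (proj₁ wu) r≁w r≁u wu∉tc rx)
  where
  open Blocks mg VH⊆VG n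
  wu : EdgeM ρ VH n w u
  wu = EdgeM-sym uw
  r≁u : ¬ Part ρ VH n r u
  r≁u = root-not-on-edge arc wH uw
  r≁w : ¬ Part ρ VH n r w
  r≁w = root-not-on-edge arc uH wu
  uw∉tc : ∀ d → Cols ρ (Blk ρ VH n u) (Blk ρ VH n w) d → ¬ TC ρ VH n r d
  uw∉tc = one-colour-outside (proj₂ uw) uw⊈tc
  wu∉tc : ∀ d → Cols ρ (Blk ρ VH n w) (Blk ρ VH n u) d → ¬ TC ρ VH n r d
  wu∉tc d wu-colour = uw∉tc d (Blk-Cols-swap wu-colour)
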